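{- Let $n \ge 1$ and $t \ge 1$ be integers, and let $\alpha, \beta, \gamma \in \mathbb{F}_{3^n}^*$. Define $f: \mathbb{F}_{3^n} \to \mathbb{F}_{3^n}$ by $$f(x) = \begin{cases} 0 & \text{if } x = 0, \\ \alpha(x^3 + \gamma x^2 + \gamma^2 x) & \text{if } x \in C_0, \\ \beta x^t & \text{if } x \in C_1. \end{cases}$$ Suppose $f$ is a permutation of $\mathbb{F}_{3^n}$ and $\eta(\alpha) = (-1)^m$ with $m \in \{0,1\}$. Then the inverse of $f$ on $\mathbb{F}_{3^n}$ is $$f^{ -1}(x) = -u(x)\left(1 + (-1)^m x^{(3^n-1)/2}\right) - v(x)\left(1 + (-1)^{m+1} x^{(3^n-1)/2}\right),$$ where: - $u(x) = \sum_{0 \le j,k \le n-1} \gamma \left(\alpha^{ -1}\gamma^{ -3} x\right)^{\frac{3^j+3^k}{2}}$; - $v(x) = (-1)^r (\beta^{ -1} x)^s$, with $r, s$ integers such that $1 \le s < (3^n-1)/2$ and $st + r(3^n-1)/2 = 1$.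
   Context: $C_0 = \{e^2 : e \in \mathbb{F}_{3^n}^*\}$ and $C_1 = \mathbb{F}_{3^n}^* \setminus C_0$. $\eta$ is the quadratic character of $\mathbb{F}_{3^n}$: $\eta(a) = 1$ on $C_0$ and $-1$ on $C_1$. The inverse of $f$ is a polynomial $g$ with $g(f(c)) = c$ for all $c \in \mathbb{F}_{3^n}$. It is known that such $f$ is a permutation if and only if $\gcd(t, \frac{3^n-1}{2}) = 1$, $\eta(\gamma) = -1$ and $\eta(\alpha) = \eta(\beta)(-1)^{t+1}$. -}

module Defs where

open import Level using (0ℓ)
open import Data.Nat using (ℕ; zero; suc)
open import Data.Fin using (Fin)
open import Data.List using (List; foldr; map; upTo)
open import Data.Product using (Σ; _×_)
open import Relation.Nullary using (¬_)
open import Relation.Binary.PropositionalEquality using (_≡_)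
open import Relation.Binary.Definitions using (DecidableEquality)
open import Algebra.Structures using (IsCommutativeRing)
open import Function.Bundles using (_↔_)

-- A finite field with exactly q elements (equality is propositional).
-- Every field with 3^n elements is (isomorphic to) F_{3^n}.
record FiniteField (q : ℕ) : Set₁ where
  infixl 6 _⊕_
  infixl 7 _⊗_
  infixr 8 _^ᶠ_
  field
    F        : Set
    0# 1#    : F
    _⊕_ _⊗_  : F → F → F
    ⊝_       : F → F
    _⁻¹      : F → F   -- multiplicative inverse (value at 0 irrelevant)
    isCommutativeRing : IsCommutativeRing _≡_ _⊕_ _⊗_ ⊝_ 0# 1#
    0≢1      : ¬ (0# ≡ 1#)
    ⁻¹-inverse : ∀ x → ¬ (x ≡ 0#) → x ⊗ (x ⁻¹) ≡ 1#
    _≟_      : DecidableEquality F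
    enumeration : Fin q ↔ F

  _^ᶠ_ : F → ℕ → F
  x ^ᶠ zero  = 1#
  x ^ᶠ suc k = x ⊗ (x ^ᶠ k)

  negOnePow : ℕ → F
  negOnePow k = (⊝ 1#) ^ᶠ k

  sumRange : ℕ → (ℕ → F) → F
  sumRange n g = foldr _⊕_ 0# (map g (upTo n))

  C₀ : F → Set
  C₀ a = ¬ (a ≡ 0#) × Σ F (λ e → ¬ (e ≡ 0#) × (e ⊗ e ≡ a))

  C₁ : F → Set
  C₁ a = ¬ (a ≡ 0#) × ¬ C₀ a

  -- η(a) = (-1)^m  (for m ∈ {0,1}): m = 0 means a ∈ C₀, m = 1 means a ∈ C₁
  EtaIs : F → ℕ → Set
  EtaIs a zero    = C₀ a
  EtaIs a (suc _) = C₁ a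

-- By Euler's criterion x ^ h = ±1 (h = (3ⁿ − 1) / 2), proved by pairing z with c z⁻¹ in the
-- product of all nonzero elements, f x ^ h equals ε = α ^ h = η(α) on C₀ and −ε on C₁: on C₀,
-- f x = α x (x − γ)² in characteristic three, and on C₁ the value is independent of x and is
-- forced to be −ε by surjectivity. So the factors 1 ± ε y ^ h select the branch.
-- On C₀, with w = x / γ, the double sum u telescopes by Frobenius to x (w ^ h − 1)², and
-- w ^ h = −1 because γ is a nonsquare (f γ = 0 = f 0); hence u (f x) = x. On C₁,
-- v (f x) = ± x ^ (s t) = x since s t = 1 + h ∣r∣ and x ^ h = −1.

module Submission where

open import Defs
open import Data.Nat using (ℕ; _≤_; _<_; _^_; _∸_; _/_)
open import Data.Integer using (ℤ; +_; ∣_∣) renaming (_+_ to _+ℤ_; _*_ to _*ℤ_)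
open import Data.Nat using () renaming (_+_ to _+ℕ_)
open import Relation.Nullary using (¬_)
open import Relation.Binary.PropositionalEquality using (_≡_)
open import Function.Definitions using (Bijective)

import Level
open import Level using (0ℓ)
open import Algebra.Bundles using (CommutativeRing; CommutativeMonoid; RawRing)
open import Algebra.Solver.Ring.AlmostCommutativeRing using (fromCommutativeRing; _-Raw-AlmostCommutative⟶_)
import Data.Bool as Bool
open import Data.Bool using (Bool; true; false; not; _∧_; if_then_else_)
open import Data.Bool.Properties using (∧-conicalˡ; ∧-conicalʳ)
open import Data.Empty using (⊥-elim)
open import Data.Fin using (Fin)
open import Data.Fin.Permutation using (Permutation; _⟨$⟩ʳ_)
open import Data.Fin.Properties using (punchInᵢ≢i; any?)
open import Data.Integer as ℤ using (-[1+_])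
import Data.Integer.Properties as ℤ
open import Data.Integer.Solver renaming (module +-*-Solver to ℤ-Solver)
open import Data.List using (foldr)
open import Data.List.Properties using (map-applyUpTo)
open import Data.Maybe using (Maybe; just; nothing)
open import Data.Nat as ℕ using (zero; suc; s≤s; z≤n)
import Data.Nat.Properties as ℕ
open import Data.Nat.DivMod using (m*n/n≡m)
open import Data.Nat.Solver using (module +-*-Solver)
open import Data.Product using (∃; _,_; proj₁; proj₂)
import Data.Sum
open import Data.Sum using (_⊎_; inj₁; inj₂; [_,_]′)
open import Data.Vec.Functional using (removeAt)
open import Function using (id; _∘_; case_of_)
open import Function.Bundles using (_↔_; Inverse; mk↔ₛ′)
open import Function.Consequences.Propositional using (surjective⇒strictlySurjective)
open import Function.Definitions using (Injective; StrictlySurjective)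
open import Relation.Binary.Definitions using (DecidableEquality)
open import Relation.Binary.PropositionalEquality
  using (_≢_; refl; sym; trans; cong; cong₂; subst; module ≡-Reasoning)
open import Relation.Nullary using (yes; no; does; contradiction)
open import Relation.Nullary.Decidable using (dec-true; dec-false; decidable-stable)

-- Arithmetic of the exponents

[m+m]/2≡m : ∀ m → (m +ℕ m) / 2 ≡ m
[m+m]/2≡m m = trans (cong (_/ 2) (+-*-Solver.solve 1 (λ x → x :+ x := x :* con 2) refl m)) (m*n/n≡m m 2)
  where open +-*-Solver

repunit : ℕ → ℕ
repunit zero    = 0
repunit (suc j) = repunit j +ℕ 3 ^ j

3^j≡1+2*repunit : ∀ j → 3 ^ j ≡ suc (repunit j +ℕ repunit j)
3^j≡1+2*repunit zero    = refl
3^j≡1+2*repunit (suc j) rewrite 3^j≡1+2*repunit j =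
  solve 1 (λ a → con 3 :* (con 1 :+ (a :+ a)) := con 1 :+ ((a :+ (con 1 :+ (a :+ a))) :+ (a :+ (con 1 :+ (a :+ a))))) refl (repunit j)
  where open +-*-Solver

[3^n∸1]/2≡repunit : ∀ n → (3 ^ n ∸ 1) / 2 ≡ repunit n
[3^n∸1]/2≡repunit n rewrite 3^j≡1+2*repunit n = [m+m]/2≡m (repunit n)

3^j+3^k≡2*[1+repunit+repunit] : ∀ j k → 3 ^ j +ℕ 3 ^ k ≡ let e = suc (repunit j +ℕ repunit k) in e +ℕ e
3^j+3^k≡2*[1+repunit+repunit] j k rewrite 3^j≡1+2*repunit j | 3^j≡1+2*repunit k =
  solve 2 (λ a b → (con 1 :+ (a :+ a)) :+ (con 1 :+ (b :+ b)) := (con 1 :+ (a :+ b)) :+ (con 1 :+ (a :+ b))) refl (repunit j) (repunit k)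
  where open +-*-Solver

[3^j+3^k]/2≡1+repunit+repunit : ∀ j k → (3 ^ j +ℕ 3 ^ k) / 2 ≡ suc (repunit j +ℕ repunit k)
[3^j+3^k]/2≡1+repunit+repunit j k =
  trans (cong (_/ 2) (3^j+3^k≡2*[1+repunit+repunit] j k)) ([m+m]/2≡m _)

-- A Bézout relation s t + r h = 1 with s, t, h positive forces r ≤ 0.
bezout⇒t*s≡1+h*∣r∣ : ∀ {s t h} r → 1 ≤ s → 1 ≤ t → 1 ≤ h →
  + s *ℤ + t +ℤ r *ℤ + h ≡ + 1 → t ℕ.* s ≡ suc (h ℕ.* ∣ r ∣)
bezout⇒t*s≡1+h*∣r∣ {s} {t} {h} (+ zero) _ _ _ eq = begin
  t ℕ.* s        ≡⟨ ℕ.*-comm t s ⟩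
  s ℕ.* t        ≡⟨ ℤ.+-injective (trans (ℤ.pos-* s t) (trans (sym (ℤ.+-identityʳ _)) eq)) ⟩
  1              ≡⟨ cong suc (sym (ℕ.*-zeroʳ h)) ⟩
  suc (h ℕ.* 0)  ∎
  where open ≡-Reasoning
bezout⇒t*s≡1+h*∣r∣ {s} {t} {h} (+ suc k) 1≤s 1≤t 1≤h eq = ⊥-elim (ℕ.<-irrefl refl (begin-strict
  1                          <⟨ ℕ.+-mono-≤ (ℕ.*-mono-≤ 1≤s 1≤t) (ℕ.*-mono-≤ (s≤s (z≤n {k})) 1≤h) ⟩
  s ℕ.* t +ℕ suc k ℕ.* h     ≡⟨ ℤ.+-injective (trans (cong₂ _+ℤ_ (ℤ.pos-* s t) (ℤ.pos-* (suc k) h)) eq) ⟩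
  1                          ∎))
  where open ℕ.≤-Reasoning
bezout⇒t*s≡1+h*∣r∣ {s} {t} {h} -[1+ k ] _ _ _ eq = ℤ.+-injective (begin
  + (t ℕ.* s)
    ≡⟨ ℤ.pos-* t s ⟩
  + t *ℤ + s
    ≡⟨ solve 4 (λ s t a h → t :* s := (s :* t :+ (:- a) :* h) :+ h :* a) refl (+ s) (+ t) (+ suc k) (+ h) ⟩
  (+ s *ℤ + t +ℤ -[1+ k ] *ℤ + h) +ℤ + h *ℤ + suc k
    ≡⟨ cong₂ _+ℤ_ eq (sym (ℤ.pos-* h (suc k))) ⟩
  + suc (h ℕ.* suc k) ∎)
  where
  open ℤ-Solver
  open ≡-Reasoning

-- A ring solver for commutative rings of characteristic three

data ℤ/3 : Set where
  0₃ 1₃ 2₃ : ℤ/3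

module _ {c ℓ} (R : CommutativeRing c ℓ) where

  open CommutativeRing R

  module CharacteristicThree (1+1+1≈0 : 1# + 1# + 1# ≈ 0#) where

    open import Algebra.Properties.Ring ring
    open CommutativeRing R using () renaming (refl to ≈-refl; sym to ≈-sym; trans to ≈-trans)
    open import Relation.Binary.Reasoning.Setoid setoid

    private
      _+₃_ : ℤ/3 → ℤ/3 → ℤ/3
      0₃ +₃ y  = y
      1₃ +₃ 0₃ = 1₃
      1₃ +₃ 1₃ = 2₃
      1₃ +₃ 2₃ = 0₃
      2₃ +₃ 0₃ = 2₃
      2₃ +₃ 1₃ = 0₃
      2₃ +₃ 2₃ = 1₃

      _*₃_ : ℤ/3 → ℤ/3 → ℤ/3
      0₃ *₃ _  = 0₃
      1₃ *₃ y  = y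
      2₃ *₃ 0₃ = 0₃
      2₃ *₃ 1₃ = 2₃
      2₃ *₃ 2₃ = 1₃

      -₃_ : ℤ/3 → ℤ/3
      -₃ 0₃ = 0₃
      -₃ 1₃ = 2₃
      -₃ 2₃ = 1₃

      ℤ/3-rawRing : RawRing 0ℓ 0ℓ
      ℤ/3-rawRing = record
        { _≈_ = _≡_ ; _+_ = _+₃_ ; _*_ = _*₃_ ; -_ = -₃_ ; 0# = 0₃ ; 1# = 1₃ }

      ⟦_⟧₃ : ℤ/3 → Carrier
      ⟦ 0₃ ⟧₃ = 0#
      ⟦ 1₃ ⟧₃ = 1#
      ⟦ 2₃ ⟧₃ = - 1#

      1+1≈-1 : 1# + 1# ≈ - 1#
      1+1≈-1 = +-inverseˡ-unique (1# + 1#) 1# 1+1+1≈0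

      -1*-1≈1 : - 1# * - 1# ≈ 1#
      -1*-1≈1 = ≈-trans (-1*x≈-x (- 1#)) (-‿involutive 1#)

      +-homo : ∀ x y → ⟦ x +₃ y ⟧₃ ≈ ⟦ x ⟧₃ + ⟦ y ⟧₃
      +-homo 0₃ y  = ≈-sym (+-identityˡ _)
      +-homo 1₃ 0₃ = ≈-sym (+-identityʳ _)
      +-homo 1₃ 1₃ = ≈-sym 1+1≈-1
      +-homo 1₃ 2₃ = ≈-sym (-‿inverseʳ 1#)
      +-homo 2₃ 0₃ = ≈-sym (+-identityʳ _)
      +-homo 2₃ 1₃ = ≈-sym (-‿inverseˡ 1#)
      +-homo 2₃ 2₃ = begin
        1#            ≈⟨ -‿involutive 1# ⟨
        - (- 1#)      ≈⟨ -‿cong 1+1≈-1 ⟨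
        - (1# + 1#)   ≈⟨ -‿+-comm 1# 1# ⟨
        - 1# + - 1#   ∎

      *-homo : ∀ x y → ⟦ x *₃ y ⟧₃ ≈ ⟦ x ⟧₃ * ⟦ y ⟧₃
      *-homo 0₃ y  = ≈-sym (zeroˡ _)
      *-homo 1₃ y  = ≈-sym (*-identityˡ _)
      *-homo 2₃ 0₃ = ≈-sym (zeroʳ _)
      *-homo 2₃ 1₃ = ≈-sym (*-identityʳ _)
      *-homo 2₃ 2₃ = ≈-sym -1*-1≈1

      -‿homo : ∀ x → ⟦ -₃ x ⟧₃ ≈ - ⟦ x ⟧₃
      -‿homo 0₃ = ≈-sym -0#≈0#
      -‿homo 1₃ = ≈-refl
      -‿homo 2₃ = ≈-sym (-‿involutive 1#)

      ℤ/3⟶R : ℤ/3-rawRing -Raw-AlmostCommutative⟶ fromCommutativeRing R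
      ℤ/3⟶R = record
        { ⟦_⟧ = ⟦_⟧₃ ; +-homo = +-homo ; *-homo = *-homo ; -‿homo = -‿homo
        ; 0-homo = ≈-refl ; 1-homo = ≈-refl }

      coefficient≟ : ∀ a b → Maybe (⟦ a ⟧₃ ≈ ⟦ b ⟧₃)
      coefficient≟ 0₃ 0₃ = just ≈-refl
      coefficient≟ 1₃ 1₃ = just ≈-refl
      coefficient≟ 2₃ 2₃ = just ≈-refl
      coefficient≟ _  _  = nothing

    open import Algebra.Solver.Ring ℤ/3-rawRing (fromCommutativeRing R) ℤ/3⟶R coefficient≟ public

module Enumerated {a} {A : Set a} {q : ℕ} (enum : Fin q ↔ A) (_≟_ : DecidableEquality A) where

  private
    element : Fin q → A
    element = Inverse.to enum

    index : A → Fin q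
    index = Inverse.from enum

  infix 4 _∈_
  infixl 6 _∖_

  record _∈_ (x : A) (p : A → Bool) : Set where
    constructor member
    field isMember : p x ≡ true

  open _∈_

  _∖_ : (A → Bool) → A → A → Bool
  (p ∖ x) y = p y ∧ not (does (y ≟ x))

  ∈-∖⁺ : ∀ {p x y} → y ∈ p → y ≢ x → y ∈ p ∖ x
  ∈-∖⁺ {x = x} {y} (member y∈p) y≢x = member (cong₂ _∧_ y∈p (cong not (dec-false (y ≟ x) y≢x)))

  ∈-∖⁻ : ∀ {p x y} → y ∈ p ∖ x → y ∈ p
  ∈-∖⁻ (member y∈p∖x) = member (∧-conicalˡ _ _ y∈p∖x)

  ∈-∖-≢ : ∀ {p x y} → y ∈ p ∖ x → y ≢ x
  ∈-∖-≢ {x = x} {y} (member y∈p∖x) y≡x =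
    case trans (sym (∧-conicalʳ _ _ y∈p∖x)) (cong not (dec-true (y ≟ x) y≡x)) of λ ()

  module Sum {c ℓ} (M : CommutativeMonoid c ℓ) where

    open CommutativeMonoid M
      using (Carrier; _≈_; _∙_; ε; ∙-congˡ; ∙-congʳ; identityˡ; setoid)
      renaming (refl to ≈-refl; trans to ≈-trans; reflexive to ≈-reflexive)
    open import Algebra.Properties.CommutativeMonoid.Sum M using (sum; sum-remove; sum-cong-≋; sum-replicate-zero)
    open import Relation.Binary.Reasoning.Setoid setoid

    ∑ : (A → Bool) → (A → Carrier) → Carrier
    ∑ p g = sum (λ i → if p (element i) then g (element i) else ε)

    private
      sum-pick : ∀ {n} (t u : Fin n → Carrier) i → u i ≈ ε →
                 (∀ j → j ≢ i → t j ≈ u j) → sum t ≈ t i ∙ sum u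
      sum-pick {suc n} t u i uᵢ≈ε t≈u = begin
        sum t                               ≈⟨ sum-remove t ⟩
        t i ∙ sum (removeAt t i)            ≈⟨ ∙-congˡ (sum-cong-≋ λ j → t≈u _ (punchInᵢ≢i i j)) ⟩
        t i ∙ sum (removeAt u i)            ≈⟨ ∙-congˡ (identityˡ _) ⟨
        t i ∙ (ε ∙ sum (removeAt u i))      ≈⟨ ∙-congˡ (∙-congʳ uᵢ≈ε) ⟨
        t i ∙ (u i ∙ sum (removeAt u i))    ≈⟨ ∙-congˡ (sum-remove u) ⟨
        t i ∙ sum u                         ∎

    ∑-empty : ∀ p g → (∀ x → p x ≡ false) → ∑ p g ≈ ε
    ∑-empty p g p≡∅ = ≈-trans (sum-cong-≋ λ i → ≈-reflexive (cong (if_then g (element i) else ε) (p≡∅ (element i))))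
                                (sum-replicate-zero q)

    ∑-remove : ∀ {p x} g → x ∈ p → ∑ p g ≈ g x ∙ ∑ (p ∖ x) g
    ∑-remove {p} {x} g x∈p = ≈-trans (sum-pick _ _ (index x) at-x off-x) (∙-congʳ (≈-reflexive gx))
      where
      x-at : element (index x) ≡ x
      x-at = Inverse.strictlyInverseˡ enum x
      gx : (if p (element (index x)) then g (element (index x)) else ε) ≡ g x
      gx rewrite x-at | isMember x∈p = refl
      at-x : (if (p ∖ x) (element (index x)) then g (element (index x)) else ε) ≈ ε
      at-x rewrite x-at with p x | x ≟ x
      ... | _     | no x≢x = contradiction refl x≢x
      ... | true  | yes _  = ≈-refl
      ... | false | yes _  = ≈-refl
      off-x : ∀ j → j ≢ index x → (if p (element j) then g (element j) else ε)
                                  ≈ (if (p ∖ x) (element j) then g (element j) else ε)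
      off-x j j≢ with element j ≟ x
      ... | yes refl = contradiction (Inverse.strictlyInverseʳ enum j) (j≢ ∘ sym)
      ... | no _ with p (element j)
      ...   | true  = ≈-refl
      ...   | false = ≈-refl

  empty-or-inhabited : (p : A → Bool) → (∀ x → p x ≡ false) ⊎ ∃ (_∈ p)
  empty-or-inhabited p with any? (λ i → p (element i) Bool.≟ true)
  ... | yes (i , i∈p) = inj₂ (element i , member i∈p)
  ... | no ∄ = inj₁ absent
    where
    absent : ∀ x → p x ≡ false
    absent x with p x in eq
    ... | false = refl
    ... | true  = contradiction (index x , trans (cong p (Inverse.strictlyInverseˡ enum x)) eq) ∄

  open Sum ℕ.+-0-commutativeMonoid using () renaming (∑ to ∑ℕ; ∑-empty to ∑ℕ-empty; ∑-remove to ∑ℕ-remove)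

  size : (A → Bool) → ℕ
  size p = ∑ℕ p (λ _ → 1)

  size-∖ : ∀ {p x} → x ∈ p → size p ≡ suc (size (p ∖ x))
  size-∖ = ∑ℕ-remove (λ _ → 1)

  size-full : size (λ _ → true) ≡ q
  size-full = sum1≡n q
    where
    open import Algebra.Definitions.RawMonoid ℕ.+-0-rawMonoid using (sum)
    sum1≡n : ∀ n → sum {n} (λ _ → 1) ≡ n
    sum1≡n zero    = refl
    sum1≡n (suc n) = cong suc (sum1≡n n)

  module _ {c ℓ} (M : CommutativeMonoid c ℓ) where

    open CommutativeMonoid M using (Carrier)

    module Pairing (g : A → Carrier) (σ : A → A) (c : Carrier) where

      open CommutativeMonoid M
        using (_≈_; _∙_; ε; ∙-cong; ∙-congˡ; assoc; setoid; rawMonoid)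
      open Sum M
      open import Algebra.Definitions.RawMonoid rawMonoid using (_×_)
      open import Relation.Binary.Reasoning.Setoid setoid

      record PairsOff (p : A → Bool) : Set (a Level.⊔ ℓ) where
        field
          closed         : ∀ {x} → x ∈ p → σ x ∈ p
          fixedPointFree : ∀ {x} → x ∈ p → σ x ≢ x
          involutive     : ∀ {x} → x ∈ p → σ (σ x) ≡ x
          pairProduct    : ∀ {x} → x ∈ p → g x ∙ g (σ x) ≈ c

      PairsOff-∖ : ∀ {p x} → PairsOff p → x ∈ p → PairsOff (p ∖ x ∖ σ x)
      PairsOff-∖ {p} {x} pairs x∈p = record
        { closed         = λ z∈ → ∈-∖⁺ (∈-∖⁺ (closed (in-p z∈)) (σz≢x z∈)) (σz≢σx z∈)
        ; fixedPointFree = fixedPointFree ∘ in-p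
        ; involutive     = involutive ∘ in-p
        ; pairProduct    = pairProduct ∘ in-p
        }
        where
        open PairsOff pairs
        in-p : ∀ {z} → z ∈ p ∖ x ∖ σ x → z ∈ p
        in-p = ∈-∖⁻ ∘ ∈-∖⁻
        σz≢x : ∀ {z} → z ∈ p ∖ x ∖ σ x → σ z ≢ x
        σz≢x z∈ σz≡x = ∈-∖-≢ z∈ (trans (sym (involutive (in-p z∈))) (cong σ σz≡x))
        σz≢σx : ∀ {z} → z ∈ p ∖ x ∖ σ x → σ z ≢ σ x
        σz≢σx z∈ σz≡σx = ∈-∖-≢ (∈-∖⁻ z∈)
          (trans (sym (involutive (in-p z∈))) (trans (cong σ σz≡σx) (involutive x∈p)))

      ∑-PairsOff : ∀ m {p} → size p ≡ m +ℕ m → PairsOff p → ∑ p g ≈ m × c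
      ∑-PairsOff m {p} size≡ pairs with empty-or-inhabited p | m
      ... | inj₁ p≡∅ | zero  = ∑-empty p g p≡∅
      ... | inj₁ p≡∅ | suc m = contradiction (trans (sym (∑ℕ-empty p _ p≡∅)) size≡) λ ()
      ... | inj₂ (x , x∈p) | zero = contradiction (trans (sym (size-∖ x∈p)) size≡) λ ()
      ... | inj₂ (x , x∈p) | suc m = begin
        ∑ p g                              ≈⟨ ∑-remove g x∈p ⟩
        g x ∙ ∑ (p ∖ x) g                  ≈⟨ ∙-congˡ (∑-remove g σx∈p∖x) ⟩
        g x ∙ (g (σ x) ∙ ∑ (p ∖ x ∖ σ x) g) ≈⟨ assoc _ _ _ ⟨
        (g x ∙ g (σ x)) ∙ ∑ (p ∖ x ∖ σ x) g ≈⟨ ∙-cong (pairProduct x∈p) (∑-PairsOff m size′ (PairsOff-∖ pairs x∈p)) ⟩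
        c ∙ (m × c)                        ∎
        where
        open PairsOff pairs
        σx∈p∖x : σ x ∈ p ∖ x
        σx∈p∖x = ∈-∖⁺ (closed x∈p) (fixedPointFree x∈p)
        size′ : size (p ∖ x ∖ σ x) ≡ m +ℕ m
        size′ = ℕ.suc-injective (ℕ.suc-injective (trans (sym (cong suc (size-∖ σx∈p∖x)))
                  (trans (sym (size-∖ x∈p)) (trans size≡ (cong suc (ℕ.+-suc m m))))))

module FieldProperties {q : ℕ} (K : FiniteField q) where

  open FiniteField K

  commutativeRing : CommutativeRing 0ℓ 0ℓ
  commutativeRing = record { isCommutativeRing = isCommutativeRing }

  open CommutativeRing commutativeRing public
    using ( +-assoc; +-comm; +-identityˡ; +-identityʳ; -‿inverseˡ; -‿inverseʳ
          ; *-assoc; *-comm; *-identityˡ; *-identityʳ; zeroˡ; zeroʳ; distribˡ; distribʳ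
          ; ring; +-commutativeMonoid; *-commutativeMonoid)
  open import Algebra.Properties.Ring ring public
    using ( -‿involutive; -0#≈0#; +-cancelˡ; +-inverseˡ-unique; -‿distribʳ-*; -1*x≈-x
          ; x∙y⁻¹≈ε⇒x≈y; [y-z]x≈yx-zx; -‿distribˡ-*; -‿injective)
  open ≡-Reasoning

  1≢0 : 1# ≢ 0#
  1≢0 = 0≢1 ∘ sym

  ⁻¹-inverseˡ : ∀ {x} → x ≢ 0# → x ⁻¹ ⊗ x ≡ 1#
  ⁻¹-inverseˡ {x} x≢0 = trans (*-comm _ _) (⁻¹-inverse x x≢0)

  *-cancelˡ : ∀ {x y z} → x ≢ 0# → x ⊗ y ≡ x ⊗ z → y ≡ z
  *-cancelˡ {x} {y} {z} x≢0 xy≡xz = begin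
    y                ≡⟨ *-identityˡ y ⟨
    1# ⊗ y           ≡⟨ cong (_⊗ y) (⁻¹-inverseˡ x≢0) ⟨
    (x ⁻¹ ⊗ x) ⊗ y   ≡⟨ *-assoc _ _ _ ⟩
    x ⁻¹ ⊗ (x ⊗ y)   ≡⟨ cong (x ⁻¹ ⊗_) xy≡xz ⟩
    x ⁻¹ ⊗ (x ⊗ z)   ≡⟨ *-assoc _ _ _ ⟨
    (x ⁻¹ ⊗ x) ⊗ z   ≡⟨ cong (_⊗ z) (⁻¹-inverseˡ x≢0) ⟩
    1# ⊗ z           ≡⟨ *-identityˡ z ⟩
    z                ∎

  x*y≡0⇒x≡0⊎y≡0 : ∀ {x y} → x ⊗ y ≡ 0# → x ≡ 0# ⊎ y ≡ 0#
  x*y≡0⇒x≡0⊎y≡0 {x} {y} xy≡0 with x ≟ 0#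
  ... | yes x≡0 = inj₁ x≡0
  ... | no x≢0  = inj₂ (*-cancelˡ x≢0 (trans xy≡0 (sym (zeroʳ x))))

  x*y≢0 : ∀ {x y} → x ≢ 0# → y ≢ 0# → x ⊗ y ≢ 0#
  x*y≢0 x≢0 y≢0 xy≡0 = [ x≢0 , y≢0 ]′ (x*y≡0⇒x≡0⊎y≡0 xy≡0)

  ⁻¹-unique : ∀ {x y} → x ⊗ y ≡ 1# → y ≡ x ⁻¹
  ⁻¹-unique {x} {y} xy≡1 = *-cancelˡ x≢0 (trans xy≡1 (sym (⁻¹-inverse x x≢0)))
    where
    x≢0 : x ≢ 0#
    x≢0 x≡0 = 1≢0 (trans (sym xy≡1) (trans (cong (_⊗ y) x≡0) (zeroˡ y)))

  ⁻¹≢0 : ∀ {x} → x ≢ 0# → x ⁻¹ ≢ 0#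
  ⁻¹≢0 {x} x≢0 x⁻¹≡0 = 1≢0 (trans (sym (⁻¹-inverse x x≢0)) (trans (cong (x ⊗_) x⁻¹≡0) (zeroʳ x)))

  ^ᶠ-homo-* : ∀ x m n → x ^ᶠ (m +ℕ n) ≡ x ^ᶠ m ⊗ x ^ᶠ n
  ^ᶠ-homo-* x zero    n = sym (*-identityˡ _)
  ^ᶠ-homo-* x (suc m) n = trans (cong (x ⊗_) (^ᶠ-homo-* x m n)) (sym (*-assoc _ _ _))

  ^ᶠ-assocʳ : ∀ x m n → (x ^ᶠ m) ^ᶠ n ≡ x ^ᶠ (m ℕ.* n)
  ^ᶠ-assocʳ x m zero    = cong (x ^ᶠ_) (sym (ℕ.*-zeroʳ m))
  ^ᶠ-assocʳ x m (suc n) = begin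
    x ^ᶠ m ⊗ (x ^ᶠ m) ^ᶠ n    ≡⟨ cong (x ^ᶠ m ⊗_) (^ᶠ-assocʳ x m n) ⟩
    x ^ᶠ m ⊗ x ^ᶠ (m ℕ.* n)   ≡⟨ ^ᶠ-homo-* x m (m ℕ.* n) ⟨
    x ^ᶠ (m +ℕ m ℕ.* n)       ≡⟨ cong (x ^ᶠ_) (ℕ.*-suc m n) ⟨
    x ^ᶠ (m ℕ.* suc n)        ∎

  ^ᶠ-distrib-* : ∀ x y n → (x ⊗ y) ^ᶠ n ≡ x ^ᶠ n ⊗ y ^ᶠ n
  ^ᶠ-distrib-* x y zero    = sym (*-identityˡ 1#)
  ^ᶠ-distrib-* x y (suc n) = begin
    (x ⊗ y) ⊗ (x ⊗ y) ^ᶠ n         ≡⟨ cong ((x ⊗ y) ⊗_) (^ᶠ-distrib-* x y n) ⟩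
    (x ⊗ y) ⊗ (x ^ᶠ n ⊗ y ^ᶠ n)    ≡⟨ *-assoc x y _ ⟩
    x ⊗ (y ⊗ (x ^ᶠ n ⊗ y ^ᶠ n))    ≡⟨ cong (x ⊗_) (x∙yz≈y∙xz y _ _) ⟩
    x ⊗ (x ^ᶠ n ⊗ (y ⊗ y ^ᶠ n))    ≡⟨ *-assoc x _ _ ⟨
    (x ⊗ x ^ᶠ n) ⊗ (y ⊗ y ^ᶠ n)    ∎
    where open import Algebra.Properties.CommutativeSemigroup (CommutativeMonoid.commutativeSemigroup *-commutativeMonoid)

  1^ᶠn≡1 : ∀ n → 1# ^ᶠ n ≡ 1#
  1^ᶠn≡1 zero    = refl
  1^ᶠn≡1 (suc n) = trans (*-identityˡ _) (1^ᶠn≡1 n)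

  x^ᶠn≢0 : ∀ {x} n → x ≢ 0# → x ^ᶠ n ≢ 0#
  x^ᶠn≢0 zero    x≢0 = 1≢0
  x^ᶠn≢0 (suc n) x≢0 = x*y≢0 x≢0 (x^ᶠn≢0 n x≢0)

  0^ᶠn≡0 : ∀ {n} → 1 ≤ n → 0# ^ᶠ n ≡ 0#
  0^ᶠn≡0 {suc n} _ = zeroˡ _

  x^ᶠn≡0⇒x≡0 : ∀ {x} n → x ^ᶠ n ≡ 0# → x ≡ 0#
  x^ᶠn≡0⇒x≡0 {x} n xⁿ≡0 with x ≟ 0#
  ... | yes x≡0 = x≡0
  ... | no x≢0  = contradiction xⁿ≡0 (x^ᶠn≢0 n x≢0)

  negOnePow-+1 : ∀ k → negOnePow (k +ℕ 1) ≡ ⊝ negOnePow k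
  negOnePow-+1 zero    = *-identityʳ (⊝ 1#)
  negOnePow-+1 (suc k) = begin
    ⊝ 1# ⊗ negOnePow (k +ℕ 1)   ≡⟨ cong (⊝ 1# ⊗_) (negOnePow-+1 k) ⟩
    ⊝ 1# ⊗ ⊝ negOnePow k        ≡⟨ -‿distribʳ-* (⊝ 1#) (negOnePow k) ⟨
    ⊝ (⊝ 1# ⊗ negOnePow k)      ∎

  negOnePow-square : ∀ k → negOnePow k ⊗ negOnePow k ≡ 1#
  negOnePow-square k = begin
    negOnePow k ⊗ negOnePow k   ≡⟨ ^ᶠ-distrib-* (⊝ 1#) (⊝ 1#) k ⟨
    (⊝ 1# ⊗ ⊝ 1#) ^ᶠ k          ≡⟨ cong (_^ᶠ k) -1*-1≡1 ⟩
    1# ^ᶠ k                     ≡⟨ 1^ᶠn≡1 k ⟩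
    1#                          ∎
    where
    -1*-1≡1 : ⊝ 1# ⊗ ⊝ 1# ≡ 1#
    -1*-1≡1 = trans (-1*x≈-x (⊝ 1#)) (-‿involutive 1#)

  sumRange-suc : ∀ n g → sumRange (suc n) g ≡ g 0 ⊕ sumRange n (g ∘ suc)
  sumRange-suc n g = cong (λ xs → g 0 ⊕ foldr _⊕_ 0# xs)
    (trans (map-applyUpTo suc g n) (sym (map-applyUpTo id (g ∘ suc) n)))

  sumRange-cong : ∀ n {g g′} → (∀ j → g j ≡ g′ j) → sumRange n g ≡ sumRange n g′
  sumRange-cong zero    g≗g′ = refl
  sumRange-cong (suc n) {g} {g′} g≗g′ = begin
    sumRange (suc n) g               ≡⟨ sumRange-suc n g ⟩
    g 0 ⊕ sumRange n (g ∘ suc)       ≡⟨ cong₂ _⊕_ (g≗g′ 0) (sumRange-cong n (g≗g′ ∘ suc)) ⟩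
    g′ 0 ⊕ sumRange n (g′ ∘ suc)     ≡⟨ sumRange-suc n g′ ⟨
    sumRange (suc n) g′              ∎

  *-distribˡ-sumRange : ∀ x n g → x ⊗ sumRange n g ≡ sumRange n (λ j → x ⊗ g j)
  *-distribˡ-sumRange x zero    g = zeroʳ x
  *-distribˡ-sumRange x (suc n) g = begin
    x ⊗ sumRange (suc n) g                          ≡⟨ cong (x ⊗_) (sumRange-suc n g) ⟩
    x ⊗ (g 0 ⊕ sumRange n (g ∘ suc))                ≡⟨ distribˡ x _ _ ⟩
    x ⊗ g 0 ⊕ x ⊗ sumRange n (g ∘ suc)              ≡⟨ cong (x ⊗ g 0 ⊕_) (*-distribˡ-sumRange x n (g ∘ suc)) ⟩
    x ⊗ g 0 ⊕ sumRange n (λ j → x ⊗ g (suc j))      ≡⟨ sumRange-suc n _ ⟨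
    sumRange (suc n) (λ j → x ⊗ g j)                ∎

  sumRange-telescope : ∀ n (d : ℕ → F) → sumRange n (λ j → d (suc j) ⊕ ⊝ d j) ≡ d n ⊕ ⊝ d 0
  sumRange-telescope zero    d = sym (-‿inverseʳ (d 0))
  sumRange-telescope (suc n) d = begin
    sumRange (suc n) (λ j → d (suc j) ⊕ ⊝ d j)      ≡⟨ sumRange-suc n _ ⟩
    (d 1 ⊕ ⊝ d 0) ⊕ sumRange n (λ j → d (2 +ℕ j) ⊕ ⊝ d (suc j))
                                                    ≡⟨ cong (d 1 ⊕ ⊝ d 0 ⊕_) (sumRange-telescope n (d ∘ suc)) ⟩
    (d 1 ⊕ ⊝ d 0) ⊕ (d (suc n) ⊕ ⊝ d 1)             ≡⟨ +-comm _ _ ⟩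
    (d (suc n) ⊕ ⊝ d 1) ⊕ (d 1 ⊕ ⊝ d 0)             ≡⟨ +-assoc _ _ _ ⟩
    d (suc n) ⊕ (⊝ d 1 ⊕ (d 1 ⊕ ⊝ d 0))             ≡⟨ cong (d (suc n) ⊕_) (+-assoc _ _ _) ⟨
    d (suc n) ⊕ ((⊝ d 1 ⊕ d 1) ⊕ ⊝ d 0)             ≡⟨ cong (λ z → d (suc n) ⊕ (z ⊕ ⊝ d 0)) (-‿inverseˡ (d 1)) ⟩
    d (suc n) ⊕ (0# ⊕ ⊝ d 0)                        ≡⟨ cong (d (suc n) ⊕_) (+-identityˡ _) ⟩
    d (suc n) ⊕ ⊝ d 0                               ∎

  sumRange-square : ∀ n a (x : ℕ → F) →
    sumRange n (λ j → sumRange n (λ k → a ⊗ (x j ⊗ x k))) ≡ a ⊗ (sumRange n x ⊗ sumRange n x)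
  sumRange-square n a x = begin
    sumRange n (λ j → sumRange n (λ k → a ⊗ (x j ⊗ x k)))
      ≡⟨ sumRange-cong n (λ j → trans (sumRange-cong n λ k → sym (*-assoc a (x j) (x k)))
                                      (sym (*-distribˡ-sumRange (a ⊗ x j) n x))) ⟩
    sumRange n (λ j → (a ⊗ x j) ⊗ S)    ≡⟨ sumRange-cong n (λ j → *-comm (a ⊗ x j) S) ⟩
    sumRange n (λ j → S ⊗ (a ⊗ x j))    ≡⟨ *-distribˡ-sumRange S n (λ j → a ⊗ x j) ⟨
    S ⊗ sumRange n (λ j → a ⊗ x j)      ≡⟨ cong (S ⊗_) (*-distribˡ-sumRange a n x) ⟨
    S ⊗ (a ⊗ S)                         ≡⟨ *-assoc S a S ⟨
    (S ⊗ a) ⊗ S                         ≡⟨ cong (_⊗ S) (*-comm S a) ⟩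
    (a ⊗ S) ⊗ S                         ≡⟨ *-assoc a S S ⟩
    a ⊗ (S ⊗ S)                         ∎
    where S = sumRange n x

module Characteristic {q : ℕ} (K : FiniteField q) where

  open FiniteField K
  open FieldProperties K
  open import Algebra.Properties.CommutativeMonoid.Sum +-commutativeMonoid
    using (sum; sum-cong-≗; ∑-distrib-+; sum-permute; sum-replicate)
  open import Algebra.Properties.Semiring.Mult (CommutativeRing.semiring commutativeRing) using (_×_)
  open ≡-Reasoning

  private
    element : Fin q → F
    element = Inverse.to enumeration

    index : F → Fin q
    index = Inverse.from enumeration

    element-index : ∀ x → element (index x) ≡ x
    element-index = Inverse.strictlyInverseˡ enumeration

    index-element : ∀ i → index (element i) ≡ i
    index-element = Inverse.strictlyInverseʳ enumeration

    shift : Permutation q q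
    shift = mk↔ₛ′ (λ i → index (element i ⊕ 1#)) (λ i → index (element i ⊕ ⊝ 1#))
      (λ i → trans (cong (λ x → index (x ⊕ 1#)) (element-index _)) (cancel (⊝ 1#) 1# (-‿inverseˡ 1#) i))
      (λ i → trans (cong (λ x → index (x ⊕ ⊝ 1#)) (element-index _)) (cancel 1# (⊝ 1#) (-‿inverseʳ 1#) i))
      where
      cancel : ∀ a b → a ⊕ b ≡ 0# → ∀ i → index ((element i ⊕ a) ⊕ b) ≡ i
      cancel a b a+b≡0 i = trans (cong index (begin
        (element i ⊕ a) ⊕ b   ≡⟨ +-assoc _ a b ⟩
        element i ⊕ (a ⊕ b)   ≡⟨ cong (element i ⊕_) a+b≡0 ⟩
        element i ⊕ 0#        ≡⟨ +-identityʳ _ ⟩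
        element i             ∎)) (index-element i)

  -- Translation by 1 permutes the field, so it leaves the sum of all elements unchanged.
  q×1≡0 : q × 1# ≡ 0#
  q×1≡0 = +-cancelˡ (sum element) (q × 1#) 0# (begin
    sum element ⊕ q × 1#                     ≡⟨ cong (sum element ⊕_) (sum-replicate q {1#}) ⟨
    sum element ⊕ sum {q} (λ _ → 1#)           ≡⟨ ∑-distrib-+ element (λ _ → 1#) ⟨
    sum (λ i → element i ⊕ 1#)               ≡⟨ sum-cong-≗ (λ i → element-index (element i ⊕ 1#)) ⟨
    sum (λ i → element (shift ⟨$⟩ʳ i))       ≡⟨ sum-permute element shift ⟨
    sum element                              ≡⟨ +-identityʳ _ ⟨
    sum element ⊕ 0#                         ∎)

module OrderPowerOfThree (n : ℕ) (K : FiniteField (3 ^ n)) where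

  open FiniteField K
  open FieldProperties K
  open import Algebra.Properties.Semiring.Mult (CommutativeRing.semiring commutativeRing)
    using (_×_; ×1-homo-*)

  1+1+1≡0 : 1# ⊕ 1# ⊕ 1# ≡ 0#
  1+1+1≡0 = begin
    1# ⊕ 1# ⊕ 1#          ≡⟨ +-assoc 1# 1# 1# ⟩
    1# ⊕ (1# ⊕ 1#)        ≡⟨ cong (λ x → 1# ⊕ (1# ⊕ x)) (+-identityʳ 1#) ⟨
    3 × 1#                ≡⟨ x^ᶠn≡0⇒x≡0 n (trans (sym (3^k×1≡[3×1]^k n)) (Characteristic.q×1≡0 K)) ⟩
    0#                    ∎
    where
    open ≡-Reasoning
    3^k×1≡[3×1]^k : ∀ k → (3 ^ k) × 1# ≡ (3 × 1#) ^ᶠ k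
    3^k×1≡[3×1]^k zero    = +-identityʳ 1#
    3^k×1≡[3×1]^k (suc k) = trans (×1-homo-* 3 (3 ^ k)) (cong (3 × 1# ⊗_) (3^k×1≡[3×1]^k k))

module _ {q : ℕ} (K : FiniteField q) where

  open FiniteField K

  module Frobenius (1+1+1≡0 : 1# ⊕ 1# ⊕ 1# ≡ 0#) where

    open FieldProperties K
    open CharacteristicThree commutativeRing 1+1+1≡0 using (solve; _:=_; _:-_; _:*_; _:^_; con)
    open ≡-Reasoning

    frobenius : ∀ j x y → (x ⊕ ⊝ y) ^ᶠ (3 ^ j) ≡ x ^ᶠ (3 ^ j) ⊕ ⊝ (y ^ᶠ (3 ^ j))
    frobenius zero    x y = solve 2 (λ x y → (x :- y) :^ 1 := x :^ 1 :- y :^ 1) refl x y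
    frobenius (suc j) x y = begin
      (x ⊕ ⊝ y) ^ᶠ (3 ℕ.* 3 ^ j)
        ≡⟨ ^ᶠ-assocʳ (x ⊕ ⊝ y) 3 (3 ^ j) ⟨
      ((x ⊕ ⊝ y) ^ᶠ 3) ^ᶠ (3 ^ j)
        ≡⟨ cong (_^ᶠ 3 ^ j) (solve 2 (λ x y → (x :- y) :^ 3 := x :^ 3 :- y :^ 3) refl x y) ⟩
      (x ^ᶠ 3 ⊕ ⊝ (y ^ᶠ 3)) ^ᶠ (3 ^ j)
        ≡⟨ frobenius j (x ^ᶠ 3) (y ^ᶠ 3) ⟩
      (x ^ᶠ 3) ^ᶠ (3 ^ j) ⊕ ⊝ ((y ^ᶠ 3) ^ᶠ (3 ^ j))
        ≡⟨ cong₂ (λ a b → a ⊕ ⊝ b) (^ᶠ-assocʳ x 3 (3 ^ j)) (^ᶠ-assocʳ y 3 (3 ^ j)) ⟩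
      x ^ᶠ (3 ℕ.* 3 ^ j) ⊕ ⊝ (y ^ᶠ (3 ℕ.* 3 ^ j)) ∎

    private
      Δ : F → ℕ → F
      Δ w j = w ^ᶠ repunit (suc j) ⊕ ⊝ (w ^ᶠ repunit j)

      -- Writing 1 + 3 + ⋯ + 3 ^ (j − 1) for (3 ^ j − 1) / 2, each exponent (3 ^ j + 3 ^ k) / 2
      -- splits the summand into a product of two telescoping differences.
      summand≡w*Δ*Δ : ∀ w j k → (w ⊗ ((w ⊕ ⊝ 1#) ⊗ (w ⊕ ⊝ 1#))) ^ᶠ ((3 ^ j +ℕ 3 ^ k) / 2) ≡ w ⊗ (Δ w j ⊗ Δ w k)
      summand≡w*Δ*Δ w j k = begin
        (w ⊗ (v ⊗ v)) ^ᶠ ((3 ^ j +ℕ 3 ^ k) / 2)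
          ≡⟨ cong ((w ⊗ (v ⊗ v)) ^ᶠ_) ([3^j+3^k]/2≡1+repunit+repunit j k) ⟩
        (w ⊗ (v ⊗ v)) ^ᶠ e
          ≡⟨ ^ᶠ-distrib-* w (v ⊗ v) e ⟩
        w ^ᶠ e ⊗ (v ⊗ v) ^ᶠ e
          ≡⟨ cong (w ^ᶠ e ⊗_) (^ᶠ-distrib-* v v e) ⟩
        w ^ᶠ e ⊗ (v ^ᶠ e ⊗ v ^ᶠ e)
          ≡⟨ cong (w ^ᶠ e ⊗_) (^ᶠ-homo-* v e e) ⟨
        w ^ᶠ e ⊗ v ^ᶠ (e +ℕ e)
          ≡⟨ cong (λ m → w ^ᶠ e ⊗ v ^ᶠ m) (3^j+3^k≡2*[1+repunit+repunit] j k) ⟨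
        w ^ᶠ e ⊗ v ^ᶠ (3 ^ j +ℕ 3 ^ k)
          ≡⟨ cong₂ _⊗_ (cong (w ⊗_) (^ᶠ-homo-* w (repunit j) (repunit k)))
            (^ᶠ-homo-* v (3 ^ j) (3 ^ k)) ⟩
        (w ⊗ (A ⊗ B)) ⊗ (v ^ᶠ (3 ^ j) ⊗ v ^ᶠ (3 ^ k))
          ≡⟨ cong (w ⊗ (A ⊗ B) ⊗_) (cong₂ _⊗_ (frobenius-1 j) (frobenius-1 k)) ⟩
        (w ⊗ (A ⊗ B)) ⊗ ((X ⊕ ⊝ 1#) ⊗ (Y ⊕ ⊝ 1#))
          ≡⟨ solve 5 (λ w A B X Y → (w :* (A :* B)) :* ((X :- con 1₃) :* (Y :- con 1₃))
            := w :* ((A :* X :- A) :* (B :* Y :- B))) refl w A B X Y ⟩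
        w ⊗ ((A ⊗ X ⊕ ⊝ A) ⊗ (B ⊗ Y ⊕ ⊝ B))
          ≡⟨ cong₂ (λ a b → w ⊗ ((a ⊕ ⊝ A) ⊗ (b ⊕ ⊝ B)))
            (^ᶠ-homo-* w (repunit j) (3 ^ j)) (^ᶠ-homo-* w (repunit k) (3 ^ k)) ⟨
        w ⊗ (Δ w j ⊗ Δ w k) ∎
        where
        v A B X Y : F
        v = w ⊕ ⊝ 1#
        A = w ^ᶠ repunit j
        B = w ^ᶠ repunit k
        X = w ^ᶠ (3 ^ j)
        Y = w ^ᶠ (3 ^ k)
        e : ℕ
        e = suc (repunit j +ℕ repunit k)
        frobenius-1 : ∀ i → v ^ᶠ (3 ^ i) ≡ w ^ᶠ (3 ^ i) ⊕ ⊝ 1#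
        frobenius-1 i = trans (frobenius i w 1#) (cong (λ z → w ^ᶠ (3 ^ i) ⊕ ⊝ z) (1^ᶠn≡1 (3 ^ i)))

    frobenius-double-sum : ∀ N g w →
      sumRange N (λ j → sumRange N (λ k → g ⊗ (w ⊗ ((w ⊕ ⊝ 1#) ⊗ (w ⊕ ⊝ 1#))) ^ᶠ ((3 ^ j +ℕ 3 ^ k) / 2)))
      ≡ (g ⊗ w) ⊗ ((w ^ᶠ repunit N ⊕ ⊝ 1#) ⊗ (w ^ᶠ repunit N ⊕ ⊝ 1#))
    frobenius-double-sum N g w = begin
      sumRange N (λ j → sumRange N (λ k → g ⊗ (w ⊗ ((w ⊕ ⊝ 1#) ⊗ (w ⊕ ⊝ 1#))) ^ᶠ ((3 ^ j +ℕ 3 ^ k) / 2)))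
        ≡⟨ sumRange-cong N (λ j → sumRange-cong N λ k →
             trans (cong (g ⊗_) (summand≡w*Δ*Δ w j k)) (sym (*-assoc g w _))) ⟩
      sumRange N (λ j → sumRange N (λ k → (g ⊗ w) ⊗ (Δ w j ⊗ Δ w k)))
        ≡⟨ sumRange-square N (g ⊗ w) (Δ w) ⟩
      (g ⊗ w) ⊗ (sumRange N (Δ w) ⊗ sumRange N (Δ w))
        ≡⟨ cong (λ S → (g ⊗ w) ⊗ (S ⊗ S)) (sumRange-telescope N (λ j → w ^ᶠ repunit j)) ⟩
      (g ⊗ w) ⊗ ((w ^ᶠ repunit N ⊕ ⊝ 1#) ⊗ (w ^ᶠ repunit N ⊕ ⊝ 1#)) ∎

-- Euler's criterion

module _ {q : ℕ} (K : FiniteField q) where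

  open FiniteField K

  module EulerCriterion (h : ℕ) (q≡1+2h : q ≡ suc (h +ℕ h)) (1+1≢0 : 1# ⊕ 1# ≢ 0#) where

    open FieldProperties K
    open Enumerated enumeration _≟_
    open Enumerated.Sum enumeration _≟_ *-commutativeMonoid using (∑; ∑-remove)
    open import Algebra.Definitions.RawMonoid (CommutativeMonoid.rawMonoid *-commutativeMonoid) using (_×_)
    open ≡-Reasoning

    ∏ : (F → Bool) → F
    ∏ p = ∑ p id

    ×≡^ᶠ : ∀ m c → m × c ≡ c ^ᶠ m
    ×≡^ᶠ zero    c = refl
    ×≡^ᶠ (suc m) c = cong (c ⊗_) (×≡^ᶠ m c)

    nonzero : F → Bool
    nonzero = (λ _ → true) ∖ 0#

    size-nonzero : size nonzero ≡ h +ℕ h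
    size-nonzero = ℕ.suc-injective (trans (sym (size-∖ (member refl))) (trans size-full q≡1+2h))

    nonzero⁺ : ∀ {z} → z ≢ 0# → z ∈ nonzero
    nonzero⁺ = ∈-∖⁺ (member refl)

    -- z ↦ c z⁻¹ pairs off the nonzero elements, its fixed points being the square roots of c.
    cofactor : F → F → F
    cofactor c z = c ⊗ z ⁻¹

    module _ {c} (c≢0 : c ≢ 0#) where

      cofactor≢0 : ∀ {z} → z ≢ 0# → cofactor c z ≢ 0#
      cofactor≢0 z≢0 = x*y≢0 c≢0 (⁻¹≢0 z≢0)

      *-cofactor : ∀ {z} → z ≢ 0# → z ⊗ cofactor c z ≡ c
      *-cofactor {z} z≢0 = begin
        z ⊗ (c ⊗ z ⁻¹)   ≡⟨ cong (z ⊗_) (*-comm c _) ⟩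
        z ⊗ (z ⁻¹ ⊗ c)   ≡⟨ *-assoc z _ c ⟨
        (z ⊗ z ⁻¹) ⊗ c   ≡⟨ cong (_⊗ c) (⁻¹-inverse z z≢0) ⟩
        1# ⊗ c           ≡⟨ *-identityˡ c ⟩
        c                ∎

      cofactor-involutive : ∀ {z} → z ≢ 0# → cofactor c (cofactor c z) ≡ z
      cofactor-involutive {z} z≢0 = sym (*-cancelˡ (cofactor≢0 z≢0) (begin
        cofactor c z ⊗ z                      ≡⟨ *-comm _ z ⟩
        z ⊗ cofactor c z                      ≡⟨ *-cofactor z≢0 ⟩
        c                                     ≡⟨ *-cofactor (cofactor≢0 z≢0) ⟨
        cofactor c z ⊗ cofactor c (cofactor c z) ∎))

      cofactor-fixed⇒root : ∀ {z} → z ≢ 0# → cofactor c z ≡ z → z ⊗ z ≡ c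
      cofactor-fixed⇒root {z} z≢0 fixed = trans (cong (z ⊗_) (sym fixed)) (*-cofactor z≢0)

      root⇒cofactor-fixed : ∀ {z} → z ≢ 0# → z ⊗ z ≡ c → cofactor c z ≡ z
      root⇒cofactor-fixed {z} z≢0 z²≡c = *-cancelˡ z≢0 (trans (*-cofactor z≢0) (sym z²≡c))

    open Enumerated.Pairing enumeration _≟_ *-commutativeMonoid id

    pairsOff-nonzero : ∀ {c} → c ≢ 0# → ¬ C₀ c → PairsOff (cofactor c) c nonzero
    pairsOff-nonzero c≢0 ¬c∈C₀ = record
      { closed         = λ z∈ → nonzero⁺ (cofactor≢0 c≢0 (≢0 z∈))
      ; fixedPointFree = λ z∈ fixed → ¬c∈C₀ (c≢0 , _ , ≢0 z∈ , cofactor-fixed⇒root c≢0 (≢0 z∈) fixed)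
      ; involutive     = cofactor-involutive c≢0 ∘ ≢0
      ; pairProduct    = *-cofactor c≢0 ∘ ≢0
      }
      where
      ≢0 : ∀ {z} → z ∈ nonzero → z ≢ 0#
      ≢0 = ∈-∖-≢

    ∏-nonsquare : ∀ {c} → c ≢ 0# → ¬ C₀ c → ∏ nonzero ≡ c ^ᶠ h
    ∏-nonsquare c≢0 ¬c∈C₀ = trans (∑-PairsOff _ _ h size-nonzero (pairsOff-nonzero c≢0 ¬c∈C₀)) (×≡^ᶠ h _)

    z²≡a²⇒z≡±a : ∀ {z a} → z ⊗ z ≡ a ⊗ a → z ≡ a ⊎ z ≡ ⊝ a
    z²≡a²⇒z≡±a {z} {a} z²≡a² = Data.Sum.map (x∙y⁻¹≈ε⇒x≈y z a) (+-inverseˡ-unique z a)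
      (x*y≡0⇒x≡0⊎y≡0 (begin
        (z ⊕ ⊝ a) ⊗ (z ⊕ a)                       ≡⟨ [y-z]x≈yx-zx (z ⊕ a) z a ⟩
        z ⊗ (z ⊕ a) ⊕ ⊝ (a ⊗ (z ⊕ a))             ≡⟨ cong₂ (λ x y → x ⊕ ⊝ y) (distribˡ z z a) (distribˡ a z a) ⟩
        (z ⊗ z ⊕ z ⊗ a) ⊕ ⊝ (a ⊗ z ⊕ a ⊗ a)       ≡⟨ cong₂ (λ x y → (x ⊕ y) ⊕ ⊝ (a ⊗ z ⊕ a ⊗ a)) z²≡a² (*-comm z a) ⟩
        (a ⊗ a ⊕ a ⊗ z) ⊕ ⊝ (a ⊗ z ⊕ a ⊗ a)       ≡⟨ cong (λ x → x ⊕ ⊝ (a ⊗ z ⊕ a ⊗ a)) (+-comm _ _) ⟩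
        (a ⊗ z ⊕ a ⊗ a) ⊕ ⊝ (a ⊗ z ⊕ a ⊗ a)       ≡⟨ -‿inverseʳ _ ⟩
        0#                                         ∎))

    -a≢a : ∀ {a} → a ≢ 0# → ⊝ a ≢ a
    -a≢a {a} a≢0 -a≡a = x*y≢0 1+1≢0 a≢0 (begin
      (1# ⊕ 1#) ⊗ a     ≡⟨ distribʳ a 1# 1# ⟩
      1# ⊗ a ⊕ 1# ⊗ a   ≡⟨ cong₂ _⊕_ (*-identityˡ a) (trans (*-identityˡ a) (sym -a≡a)) ⟩
      a ⊕ ⊝ a           ≡⟨ -‿inverseʳ a ⟩
      0#                ∎)

    -a*-a≡a*a : ∀ a → ⊝ a ⊗ ⊝ a ≡ a ⊗ a
    -a*-a≡a*a a = begin
      ⊝ a ⊗ ⊝ a       ≡⟨ -‿distribˡ-* a (⊝ a) ⟨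
      ⊝ (a ⊗ ⊝ a)     ≡⟨ cong ⊝_ (-‿distribʳ-* a a) ⟨
      ⊝ (⊝ (a ⊗ a))   ≡⟨ -‿involutive _ ⟩
      a ⊗ a           ∎

    module _ {a} (a≢0 : a ≢ 0#) where

      private
        c : F
        c = a ⊗ a
        c≢0 : c ≢ 0#
        c≢0 = x*y≢0 a≢0 a≢0
        -a≢0 : ⊝ a ≢ 0#
        -a≢0 -a≡0 = a≢0 (trans (sym (-‿involutive a)) (trans (cong ⊝_ -a≡0) -0#≈0#))
        a∈nonzero : a ∈ nonzero
        a∈nonzero = nonzero⁺ a≢0
        -a∈nonzero∖a : ⊝ a ∈ nonzero ∖ a
        -a∈nonzero∖a = ∈-∖⁺ (nonzero⁺ -a≢0) (-a≢a a≢0)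

      size-nonzero∖±a : size nonzero ≡ suc (suc (size (nonzero ∖ a ∖ ⊝ a)))
      size-nonzero∖±a = trans (size-∖ a∈nonzero) (cong suc (size-∖ -a∈nonzero∖a))

      ∏-nonzero∖±a : ∏ nonzero ≡ ⊝ c ⊗ ∏ (nonzero ∖ a ∖ ⊝ a)
      ∏-nonzero∖±a = begin
        ∏ nonzero                            ≡⟨ ∑-remove id a∈nonzero ⟩
        a ⊗ ∏ (nonzero ∖ a)                  ≡⟨ cong (a ⊗_) (∑-remove id -a∈nonzero∖a) ⟩
        a ⊗ (⊝ a ⊗ ∏ (nonzero ∖ a ∖ ⊝ a))    ≡⟨ *-assoc a (⊝ a) _ ⟨
        (a ⊗ ⊝ a) ⊗ ∏ (nonzero ∖ a ∖ ⊝ a)    ≡⟨ cong (_⊗ ∏ (nonzero ∖ a ∖ ⊝ a)) (-‿distribʳ-* a a) ⟨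
        ⊝ c ⊗ ∏ (nonzero ∖ a ∖ ⊝ a)          ∎

      pairsOff-nonzero∖±a : PairsOff (cofactor c) c (nonzero ∖ a ∖ ⊝ a)
      pairsOff-nonzero∖±a = record
        { closed = λ z∈ → ∈-∖⁺ (∈-∖⁺ (nonzero⁺ (cofactor≢0 c≢0 (≢0 z∈)))
                                 (cofactor-avoids z∈ a≢0 refl (∈-∖-≢ (∈-∖⁻ z∈))))
                                 (cofactor-avoids z∈ -a≢0 (-a*-a≡a*a a) (∈-∖-≢ z∈))
        ; fixedPointFree = λ z∈ fixed →
            [ ∈-∖-≢ (∈-∖⁻ z∈) , ∈-∖-≢ z∈ ]′ (z²≡a²⇒z≡±a (cofactor-fixed⇒root c≢0 (≢0 z∈) fixed))
        ; involutive  = cofactor-involutive c≢0 ∘ ≢0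
        ; pairProduct = *-cofactor c≢0 ∘ ≢0
        }
        where
        ≢0 : ∀ {z} → z ∈ nonzero ∖ a ∖ ⊝ a → z ≢ 0#
        ≢0 = ∈-∖-≢ ∘ ∈-∖⁻ ∘ ∈-∖⁻
        cofactor-avoids : ∀ {z} → z ∈ nonzero ∖ a ∖ ⊝ a → ∀ {b} → b ≢ 0# → b ⊗ b ≡ c → z ≢ b → cofactor c z ≢ b
        cofactor-avoids {z} z∈ {b} b≢0 b²≡c z≢b cofactor≡b = z≢b (begin
          z                          ≡⟨ cofactor-involutive c≢0 (≢0 z∈) ⟨
          cofactor c (cofactor c z)  ≡⟨ cong (cofactor c) cofactor≡b ⟩
          cofactor c b               ≡⟨ root⇒cofactor-fixed c≢0 b≢0 b²≡c ⟩
          b                          ∎)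

    ∏-square : ∀ {a} → a ≢ 0# → ∏ nonzero ≡ ⊝ ((a ⊗ a) ^ᶠ h)
    ∏-square {a} a≢0 = go h refl
      where
      c : F
      c = a ⊗ a
      go : ∀ k → k ≡ h → ∏ nonzero ≡ ⊝ (c ^ᶠ h)
      go zero    0≡h   = contradiction (trans (sym (size-nonzero∖±a a≢0))
                           (trans size-nonzero (cong (λ x → x +ℕ x) (sym 0≡h)))) λ ()
      go (suc k) 1+k≡h = begin
        ∏ nonzero                        ≡⟨ ∏-nonzero∖±a a≢0 ⟩
        ⊝ c ⊗ ∏ (nonzero ∖ a ∖ ⊝ a)      ≡⟨ cong (⊝ c ⊗_) (∑-PairsOff _ _ k size-rest (pairsOff-nonzero∖±a a≢0)) ⟩
        ⊝ c ⊗ k × c                      ≡⟨ cong (⊝ c ⊗_) (×≡^ᶠ k c) ⟩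
        ⊝ c ⊗ c ^ᶠ k                     ≡⟨ -‿distribˡ-* c _ ⟨
        ⊝ (c ^ᶠ suc k)                   ≡⟨ cong (λ e → ⊝ (c ^ᶠ e)) 1+k≡h ⟩
        ⊝ (c ^ᶠ h)                       ∎
        where
        size-rest : size (nonzero ∖ a ∖ ⊝ a) ≡ k +ℕ k
        size-rest = ℕ.suc-injective (ℕ.suc-injective (begin
          suc (suc (size (nonzero ∖ a ∖ ⊝ a)))  ≡⟨ size-nonzero∖±a a≢0 ⟨
          size nonzero                          ≡⟨ size-nonzero ⟩
          h +ℕ h                                ≡⟨ cong (λ x → x +ℕ x) 1+k≡h ⟨
          suc k +ℕ suc k                        ≡⟨ cong suc (ℕ.+-suc k k) ⟩
          suc (suc (k +ℕ k))                    ∎))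

    ∏-nonzero≡-1 : ∏ nonzero ≡ ⊝ 1#
    ∏-nonzero≡-1 = trans (∏-square 1≢0) (cong ⊝_ (trans (cong (_^ᶠ h) (*-identityˡ 1#)) (1^ᶠn≡1 h)))

    euler-C₀ : ∀ {c} → C₀ c → c ^ᶠ h ≡ 1#
    euler-C₀ {c} (_ , a , a≢0 , a²≡c) = -‿injective (begin
      ⊝ (c ^ᶠ h)          ≡⟨ cong (λ x → ⊝ (x ^ᶠ h)) a²≡c ⟨
      ⊝ ((a ⊗ a) ^ᶠ h)    ≡⟨ ∏-square a≢0 ⟨
      ∏ nonzero           ≡⟨ ∏-nonzero≡-1 ⟩
      ⊝ 1#                ∎)

    euler-C₁ : ∀ {c} → C₁ c → c ^ᶠ h ≡ ⊝ 1#
    euler-C₁ (c≢0 , ¬c∈C₀) = trans (sym (∏-nonsquare c≢0 ¬c∈C₀)) ∏-nonzero≡-1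

-- The piecewise permutation and its inverse

module _ (n t : ℕ) (K : FiniteField (3 ^ n)) where

  open FiniteField K

  module PiecewisePermutation
    (α β γ : F) (α≢0 : α ≢ 0#) (β≢0 : β ≢ 0#) (γ≢0 : γ ≢ 0#)
    (f : F → F) (f-0 : f 0# ≡ 0#)
    (f-C₀ : ∀ x → C₀ x → f x ≡ α ⊗ (x ^ᶠ 3 ⊕ γ ⊗ x ^ᶠ 2 ⊕ γ ^ᶠ 2 ⊗ x))
    (f-C₁ : ∀ x → C₁ x → f x ≡ β ⊗ x ^ᶠ t)
    (f-injective : Injective _≡_ _≡_ f) (f-surjective : StrictlySurjective _≡_ f)
    where

    open FieldProperties K
    open ≡-Reasoning

    h : ℕ
    h = (3 ^ n ∸ 1) / 2

    1+1+1≡0 : 1# ⊕ 1# ⊕ 1# ≡ 0#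
    1+1+1≡0 = OrderPowerOfThree.1+1+1≡0 n K

    open CharacteristicThree commutativeRing 1+1+1≡0 using (solve; _:=_; _:+_; _:-_; _:*_; _:^_; :-_; con)
    open Frobenius K 1+1+1≡0 using (frobenius-double-sum)

    1+1≢0 : 1# ⊕ 1# ≢ 0#
    1+1≢0 1+1≡0 = 1≢0 (begin
      1#              ≡⟨ solve 0 (con 1₃ := :- (con 1₃ :+ con 1₃)) refl ⟩
      ⊝ (1# ⊕ 1#)     ≡⟨ cong ⊝_ 1+1≡0 ⟩
      ⊝ 0#            ≡⟨ -0#≈0# ⟩
      0#              ∎)

    3^n≡1+2h : 3 ^ n ≡ suc (h +ℕ h)
    3^n≡1+2h = trans (3^j≡1+2*repunit n) (cong (λ x → suc (x +ℕ x)) (sym ([3^n∸1]/2≡repunit n)))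

    open EulerCriterion K h 3^n≡1+2h 1+1≢0 using (euler-C₀; euler-C₁; -a≢a)

    cubic : ∀ x → x ^ᶠ 3 ⊕ γ ⊗ x ^ᶠ 2 ⊕ γ ^ᶠ 2 ⊗ x ≡ x ⊗ ((x ⊕ ⊝ γ) ⊗ (x ⊕ ⊝ γ))
    cubic x = solve 2 (λ x g → x :^ 3 :+ g :* x :^ 2 :+ g :^ 2 :* x := x :* ((x :- g) :* (x :- g))) refl x γ

    f-square-or-zero : ∀ {x} → x ≡ 0# ⊎ C₀ x → f x ≡ α ⊗ (x ⊗ ((x ⊕ ⊝ γ) ⊗ (x ⊕ ⊝ γ)))
    f-square-or-zero (inj₁ refl) = trans f-0 (sym (trans (cong (α ⊗_) (zeroˡ _)) (zeroʳ α)))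
    f-square-or-zero {x} (inj₂ x∈C₀) = trans (f-C₀ x x∈C₀) (cong (α ⊗_) (cubic x))

    γ∉C₀ : ¬ C₀ γ
    γ∉C₀ γ∈C₀ = γ≢0 (f-injective (begin
      f γ                                  ≡⟨ f-square-or-zero (inj₂ γ∈C₀) ⟩
      α ⊗ (γ ⊗ ((γ ⊕ ⊝ γ) ⊗ (γ ⊕ ⊝ γ)))    ≡⟨ solve 2 (λ a g → a :* (g :* ((g :- g) :* (g :- g))) := con 0₃) refl α γ ⟩
      0#                                   ≡⟨ f-0 ⟨
      f 0#                                 ∎))

    γ^h≡-1 : γ ^ᶠ h ≡ ⊝ 1#
    γ^h≡-1 = euler-C₁ (γ≢0 , γ∉C₀)

    ε : F
    ε = α ^ᶠ h

    ε*ε≡1 : ε ⊗ ε ≡ 1#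
    ε*ε≡1 = trans (sym (^ᶠ-distrib-* α α h)) (euler-C₀ (x*y≢0 α≢0 α≢0 , α , α≢0 , refl))

    f[C₀]^h≡ε : ∀ {x} → C₀ x → f x ^ᶠ h ≡ ε
    f[C₀]^h≡ε {x} x∈C₀ = begin
      f x ^ᶠ h
        ≡⟨ cong (_^ᶠ h) (f-square-or-zero (inj₂ x∈C₀)) ⟩
      (α ⊗ (x ⊗ (d ⊗ d))) ^ᶠ h
        ≡⟨ ^ᶠ-distrib-* α _ h ⟩
      ε ⊗ (x ⊗ (d ⊗ d)) ^ᶠ h
        ≡⟨ cong (ε ⊗_) (^ᶠ-distrib-* x (d ⊗ d) h) ⟩
      ε ⊗ (x ^ᶠ h ⊗ (d ⊗ d) ^ᶠ h)
        ≡⟨ cong₂ (λ a b → ε ⊗ (a ⊗ b)) (euler-C₀ x∈C₀) (euler-C₀ (x*y≢0 d≢0 d≢0 , d , d≢0 , refl)) ⟩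
      ε ⊗ (1# ⊗ 1#)
        ≡⟨ solve 1 (λ e → e :* (con 1₃ :* con 1₃) := e) refl ε ⟩
      ε ∎
      where
      d : F
      d = x ⊕ ⊝ γ
      d≢0 : d ≢ 0#
      d≢0 d≡0 = γ∉C₀ (subst C₀ (x∙y⁻¹≈ε⇒x≈y x γ d≡0) x∈C₀)

    f[C₁]^h≡β^h*[-1]^t : ∀ {x} → C₁ x → f x ^ᶠ h ≡ β ^ᶠ h ⊗ negOnePow t
    f[C₁]^h≡β^h*[-1]^t {x} x∈C₁ = begin
      f x ^ᶠ h                 ≡⟨ cong (_^ᶠ h) (f-C₁ x x∈C₁) ⟩
      (β ⊗ x ^ᶠ t) ^ᶠ h        ≡⟨ ^ᶠ-distrib-* β _ h ⟩
      β ^ᶠ h ⊗ (x ^ᶠ t) ^ᶠ h   ≡⟨ cong (β ^ᶠ h ⊗_) (^ᶠ-assocʳ x t h) ⟩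
      β ^ᶠ h ⊗ x ^ᶠ (t ℕ.* h)  ≡⟨ cong (λ k → β ^ᶠ h ⊗ x ^ᶠ k) (ℕ.*-comm t h) ⟩
      β ^ᶠ h ⊗ x ^ᶠ (h ℕ.* t)  ≡⟨ cong (β ^ᶠ h ⊗_) (^ᶠ-assocʳ x h t) ⟨
      β ^ᶠ h ⊗ (x ^ᶠ h) ^ᶠ t   ≡⟨ cong (λ y → β ^ᶠ h ⊗ y ^ᶠ t) (euler-C₁ x∈C₁) ⟩
      β ^ᶠ h ⊗ negOnePow t     ∎

    -- Since f is onto, some x is sent to α γ, whose h-th power is −ε; such an x can only lie in C₁.
    f[C₁]^h≡-ε : ∀ {x} → C₁ x → f x ^ᶠ h ≡ ⊝ ε
    f[C₁]^h≡-ε x∈C₁ = trans (f[C₁]^h≡β^h*[-1]^t x∈C₁) (trans (sym (f[C₁]^h≡β^h*[-1]^t y∈C₁)) f[y]^h≡-ε)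
      where
      y : F
      y = proj₁ (f-surjective (α ⊗ γ))
      fy≡αγ : f y ≡ α ⊗ γ
      fy≡αγ = proj₂ (f-surjective (α ⊗ γ))
      f[y]^h≡-ε : f y ^ᶠ h ≡ ⊝ ε
      f[y]^h≡-ε = begin
        f y ^ᶠ h            ≡⟨ cong (_^ᶠ h) fy≡αγ ⟩
        (α ⊗ γ) ^ᶠ h        ≡⟨ ^ᶠ-distrib-* α γ h ⟩
        ε ⊗ γ ^ᶠ h          ≡⟨ cong (ε ⊗_) γ^h≡-1 ⟩
        ε ⊗ ⊝ 1#            ≡⟨ solve 1 (λ e → e :* (:- con 1₃) := :- e) refl ε ⟩
        ⊝ ε                 ∎
      ε≢0 : ε ≢ 0#
      ε≢0 ε≡0 = 1≢0 (trans (sym ε*ε≡1) (trans (cong (_⊗ ε) ε≡0) (zeroˡ ε)))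
      y∈C₁ : C₁ y
      y∈C₁ = (λ y≡0 → x*y≢0 α≢0 γ≢0 (trans (sym fy≡αγ) (trans (cong f y≡0) f-0)))
           , λ y∈C₀ → -a≢a ε≢0 (trans (sym f[y]^h≡-ε) (f[C₀]^h≡ε y∈C₀))

    u : F → F
    u y = sumRange n (λ j → sumRange n (λ k → γ ⊗ (α ⁻¹ ⊗ (γ ^ᶠ 3) ⁻¹ ⊗ y) ^ᶠ ((3 ^ j +ℕ 3 ^ k) / 2)))

    γ⁻¹^h≡-1 : γ ⁻¹ ^ᶠ h ≡ ⊝ 1#
    γ⁻¹^h≡-1 = begin
      γ ⁻¹ ^ᶠ h
        ≡⟨ ⁻¹-unique (trans (sym (^ᶠ-distrib-* γ _ h)) (trans (cong (_^ᶠ h) (⁻¹-inverse γ γ≢0)) (1^ᶠn≡1 h))) ⟩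
      (γ ^ᶠ h) ⁻¹
        ≡⟨ cong _⁻¹ γ^h≡-1 ⟩
      (⊝ 1#) ⁻¹
        ≡⟨ ⁻¹-unique (solve 0 (:- con 1₃ :* :- con 1₃ := con 1₃) refl) ⟨
      ⊝ 1# ∎

    γ*[x*γ⁻¹]≡x : ∀ x → γ ⊗ (x ⊗ γ ⁻¹) ≡ x
    γ*[x*γ⁻¹]≡x x = trans (solve 3 (λ g x i → g :* (x :* i) := x :* (g :* i)) refl γ x (γ ⁻¹))
                          (trans (cong (x ⊗_) (⁻¹-inverse γ γ≢0)) (*-identityʳ x))

    γ⁻¹^3≡[γ^3]⁻¹ : γ ⁻¹ ^ᶠ 3 ≡ (γ ^ᶠ 3) ⁻¹
    γ⁻¹^3≡[γ^3]⁻¹ = ⁻¹-unique (trans (sym (^ᶠ-distrib-* γ (γ ⁻¹) 3))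
                                     (trans (cong (_^ᶠ 3) (⁻¹-inverse γ γ≢0)) (1^ᶠn≡1 3)))

    α⁻¹γ⁻³f[x]≡w[w-1]² : ∀ {x} → x ≡ 0# ⊎ C₀ x →
      let w = x ⊗ γ ⁻¹ in α ⁻¹ ⊗ (γ ^ᶠ 3) ⁻¹ ⊗ f x ≡ w ⊗ ((w ⊕ ⊝ 1#) ⊗ (w ⊕ ⊝ 1#))
    α⁻¹γ⁻³f[x]≡w[w-1]² {x} x∈C₀∪0 = begin
      α ⁻¹ ⊗ (γ ^ᶠ 3) ⁻¹ ⊗ f x
        ≡⟨ cong₂ (λ a b → α ⁻¹ ⊗ a ⊗ b) (sym γ⁻¹^3≡[γ^3]⁻¹) (f-square-or-zero x∈C₀∪0) ⟩
      α ⁻¹ ⊗ i ^ᶠ 3 ⊗ (α ⊗ (x ⊗ ((x ⊕ ⊝ γ) ⊗ (x ⊕ ⊝ γ))))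
        ≡⟨ solve 5 (λ a′ a x g i →
          a′ :* i :^ 3 :* (a :* (x :* ((x :- g) :* (x :- g))))
          := (a′ :* a) :* ((x :* i) :* ((x :* i :- g :* i) :* (x :* i :- g :* i))))
          refl (α ⁻¹) α x γ i ⟩
      (α ⁻¹ ⊗ α) ⊗ (w ⊗ ((w ⊕ ⊝ (γ ⊗ i)) ⊗ (w ⊕ ⊝ (γ ⊗ i))))
        ≡⟨ cong₂ (λ a b → a ⊗ (w ⊗ ((w ⊕ ⊝ b) ⊗ (w ⊕ ⊝ b))))
          (⁻¹-inverseˡ α≢0) (⁻¹-inverse γ γ≢0) ⟩
      1# ⊗ (w ⊗ ((w ⊕ ⊝ 1#) ⊗ (w ⊕ ⊝ 1#)))
        ≡⟨ *-identityˡ _ ⟩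
      w ⊗ ((w ⊕ ⊝ 1#) ⊗ (w ⊕ ⊝ 1#)) ∎
      where
      i w : F
      i = γ ⁻¹
      w = x ⊗ i

    u∘f-square-or-zero : ∀ {x} → x ≡ 0# ⊎ C₀ x →
      let w = x ⊗ γ ⁻¹ in u (f x) ≡ x ⊗ ((w ^ᶠ h ⊕ ⊝ 1#) ⊗ (w ^ᶠ h ⊕ ⊝ 1#))
    u∘f-square-or-zero {x} x∈C₀∪0 = begin
      u (f x)
        ≡⟨ sumRange-cong n (λ j → sumRange-cong n λ k →
             cong (λ z → γ ⊗ z ^ᶠ ((3 ^ j +ℕ 3 ^ k) / 2)) (α⁻¹γ⁻³f[x]≡w[w-1]² x∈C₀∪0)) ⟩
      sumRange n (λ j → sumRange n (λ k → γ ⊗ (w ⊗ ((w ⊕ ⊝ 1#) ⊗ (w ⊕ ⊝ 1#))) ^ᶠ ((3 ^ j +ℕ 3 ^ k) / 2)))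
        ≡⟨ frobenius-double-sum n γ w ⟩
      (γ ⊗ w) ⊗ ((w ^ᶠ repunit n ⊕ ⊝ 1#) ⊗ (w ^ᶠ repunit n ⊕ ⊝ 1#))
        ≡⟨ cong₂ (λ a e → a ⊗ ((w ^ᶠ e ⊕ ⊝ 1#) ⊗ (w ^ᶠ e ⊕ ⊝ 1#))) (γ*[x*γ⁻¹]≡x x) (sym ([3^n∸1]/2≡repunit n)) ⟩
      x ⊗ ((w ^ᶠ h ⊕ ⊝ 1#) ⊗ (w ^ᶠ h ⊕ ⊝ 1#)) ∎
      where
      w : F
      w = x ⊗ γ ⁻¹

    u∘f-C₀ : ∀ {x} → C₀ x → u (f x) ≡ x
    u∘f-C₀ {x} x∈C₀ = begin
      u (f x)
        ≡⟨ u∘f-square-or-zero (inj₂ x∈C₀) ⟩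
      x ⊗ ((w ^ᶠ h ⊕ ⊝ 1#) ⊗ (w ^ᶠ h ⊕ ⊝ 1#))
        ≡⟨ cong (λ z → x ⊗ ((z ⊕ ⊝ 1#) ⊗ (z ⊕ ⊝ 1#))) w^h≡-1 ⟩
      x ⊗ ((⊝ 1# ⊕ ⊝ 1#) ⊗ (⊝ 1# ⊕ ⊝ 1#))
        ≡⟨ solve 1 (λ x → x :* ((:- con 1₃ :- con 1₃) :* (:- con 1₃ :- con 1₃)) := x) refl x ⟩
      x ∎
      where
      w = x ⊗ γ ⁻¹
      w^h≡-1 : w ^ᶠ h ≡ ⊝ 1#
      w^h≡-1 = begin
        w ^ᶠ h                 ≡⟨ ^ᶠ-distrib-* x _ h ⟩
        x ^ᶠ h ⊗ γ ⁻¹ ^ᶠ h     ≡⟨ cong₂ _⊗_ (euler-C₀ x∈C₀) γ⁻¹^h≡-1 ⟩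
        1# ⊗ ⊝ 1#              ≡⟨ *-identityˡ _ ⟩
        ⊝ 1#                   ∎

    u∘f-0 : u (f 0#) ≡ 0#
    u∘f-0 = trans (u∘f-square-or-zero (inj₁ refl)) (zeroˡ _)

    ε≡negOnePow : ∀ {m} → m ≤ 1 → EtaIs α m → ε ≡ negOnePow m
    ε≡negOnePow {zero}     _ α∈C₀ = euler-C₀ α∈C₀
    ε≡negOnePow {suc zero} _ α∈C₁ = trans (euler-C₁ α∈C₁) (sym (*-identityʳ _))
    ε≡negOnePow {suc (suc m)} (s≤s ())

    module InverseFormula (s R : ℕ) (1≤s : 1 ≤ s) (t*s≡1+h*R : t ℕ.* s ≡ suc (h ℕ.* R)) where

      v : F → F
      v y = negOnePow R ⊗ (β ⁻¹ ⊗ y) ^ᶠ s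

      v∘f-C₁ : ∀ {x} → C₁ x → v (f x) ≡ x
      v∘f-C₁ {x} x∈C₁ = begin
        negOnePow R ⊗ (β ⁻¹ ⊗ f x) ^ᶠ s
          ≡⟨ cong (λ y → negOnePow R ⊗ (β ⁻¹ ⊗ y) ^ᶠ s) (f-C₁ x x∈C₁) ⟩
        negOnePow R ⊗ (β ⁻¹ ⊗ (β ⊗ x ^ᶠ t)) ^ᶠ s
          ≡⟨ cong (λ y → negOnePow R ⊗ y ^ᶠ s) (trans (sym (*-assoc _ _ _))
            (trans (cong (_⊗ x ^ᶠ t) (⁻¹-inverseˡ β≢0)) (*-identityˡ _))) ⟩
        negOnePow R ⊗ (x ^ᶠ t) ^ᶠ s
          ≡⟨ cong (negOnePow R ⊗_) (trans (^ᶠ-assocʳ x t s) (cong (x ^ᶠ_) t*s≡1+h*R)) ⟩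
        negOnePow R ⊗ (x ⊗ x ^ᶠ (h ℕ.* R))
          ≡⟨ cong (λ y → negOnePow R ⊗ (x ⊗ y))
            (trans (sym (^ᶠ-assocʳ x h R)) (cong (_^ᶠ R) (euler-C₁ x∈C₁))) ⟩
        negOnePow R ⊗ (x ⊗ negOnePow R)
          ≡⟨ solve 2 (λ e x → e :* (x :* e) := x :* (e :* e)) refl (negOnePow R) x ⟩
        x ⊗ (negOnePow R ⊗ negOnePow R)
          ≡⟨ cong (x ⊗_) (negOnePow-square R) ⟩
        x ⊗ 1#
          ≡⟨ *-identityʳ x ⟩
        x ∎

      v∘f-0 : v (f 0#) ≡ 0#
      v∘f-0 = begin
        negOnePow R ⊗ (β ⁻¹ ⊗ f 0#) ^ᶠ s        ≡⟨ cong (λ y → negOnePow R ⊗ (β ⁻¹ ⊗ y) ^ᶠ s) f-0 ⟩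
        negOnePow R ⊗ (β ⁻¹ ⊗ 0#) ^ᶠ s          ≡⟨ cong (λ y → negOnePow R ⊗ y ^ᶠ s) (zeroʳ _) ⟩
        negOnePow R ⊗ 0# ^ᶠ s                   ≡⟨ cong (negOnePow R ⊗_) (0^ᶠn≡0 1≤s) ⟩
        negOnePow R ⊗ 0#                        ≡⟨ zeroʳ _ ⟩
        0#                                      ∎

      -- ε y ^ᶠ h is 1 on f (C₀) and −1 on f (C₁), where combine returns U and V respectively.
      combine : F → F → F → F
      combine U V p = ⊝ (U ⊗ (1# ⊕ p)) ⊕ ⊝ (V ⊗ (1# ⊕ ⊝ p))

      f⁻¹ : F → F
      f⁻¹ y = ⊝ (u y ⊗ (1# ⊕ ε ⊗ y ^ᶠ h)) ⊕ ⊝ (v y ⊗ (1# ⊕ ⊝ ε ⊗ y ^ᶠ h))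

      f⁻¹≡combine : ∀ y → f⁻¹ y ≡ combine (u y) (v y) (ε ⊗ y ^ᶠ h)
      f⁻¹≡combine y = cong (λ p → ⊝ (u y ⊗ (1# ⊕ ε ⊗ y ^ᶠ h)) ⊕ ⊝ (v y ⊗ (1# ⊕ p))) (sym (-‿distribˡ-* ε _))

      f⁻¹∘f-C₀ : ∀ {x} → C₀ x → f⁻¹ (f x) ≡ x
      f⁻¹∘f-C₀ {x} x∈C₀ = begin
        f⁻¹ (f x)
          ≡⟨ f⁻¹≡combine (f x) ⟩
        combine (u (f x)) (v (f x)) (ε ⊗ f x ^ᶠ h)
          ≡⟨ cong₂ (combine _) refl (trans (cong (ε ⊗_) (f[C₀]^h≡ε x∈C₀)) ε*ε≡1) ⟩
        combine (u (f x)) (v (f x)) 1#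
          ≡⟨ solve 2 (λ U V → :- (U :* (con 1₃ :+ con 1₃)) :- V :* (con 1₃ :- con 1₃) := U) refl (u (f x)) (v (f x)) ⟩
        u (f x)
          ≡⟨ u∘f-C₀ x∈C₀ ⟩
        x ∎

      f⁻¹∘f-C₁ : ∀ {x} → C₁ x → f⁻¹ (f x) ≡ x
      f⁻¹∘f-C₁ {x} x∈C₁ = begin
        f⁻¹ (f x)
          ≡⟨ f⁻¹≡combine (f x) ⟩
        combine (u (f x)) (v (f x)) (ε ⊗ f x ^ᶠ h)
          ≡⟨ cong₂ (combine _) refl ε*f[x]^h≡-1 ⟩
        combine (u (f x)) (v (f x)) (⊝ 1#)
          ≡⟨ solve 2 (λ U V → :- (U :* (con 1₃ :- con 1₃)) :- V :* (con 1₃ :- :- con 1₃) := V) refl (u (f x)) (v (f x)) ⟩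
        v (f x)
          ≡⟨ v∘f-C₁ x∈C₁ ⟩
        x ∎
        where
        ε*f[x]^h≡-1 : ε ⊗ f x ^ᶠ h ≡ ⊝ 1#
        ε*f[x]^h≡-1 = trans (cong (ε ⊗_) (f[C₁]^h≡-ε x∈C₁)) (trans (sym (-‿distribʳ-* ε ε)) (cong ⊝_ ε*ε≡1))

      f⁻¹∘f-0 : f⁻¹ (f 0#) ≡ 0#
      f⁻¹∘f-0 = begin
        f⁻¹ (f 0#)
          ≡⟨ f⁻¹≡combine (f 0#) ⟩
        combine (u (f 0#)) (v (f 0#)) (ε ⊗ f 0# ^ᶠ h)
          ≡⟨ cong₂ (λ U V → combine U V (ε ⊗ f 0# ^ᶠ h)) u∘f-0 v∘f-0 ⟩
        combine 0# 0# (ε ⊗ f 0# ^ᶠ h)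
          ≡⟨ solve 1 (λ p → :- (con 0₃ :* (con 1₃ :+ p)) :- con 0₃ :* (con 1₃ :- p) := con 0₃) refl _ ⟩
        0# ∎

      -- Membership in C₀ is not decidable as stated, but the goal is an equation in K,
      -- so it suffices to refute its negation.
      f⁻¹∘f : ∀ x → f⁻¹ (f x) ≡ x
      f⁻¹∘f x with x ≟ 0#
      ... | yes refl = f⁻¹∘f-0
      ... | no x≢0   = decidable-stable (f⁻¹ (f x) ≟ x)
                         λ ≢x → ≢x (f⁻¹∘f-C₁ (x≢0 , λ x∈C₀ → ≢x (f⁻¹∘f-C₀ x∈C₀)))

theorem9 : (n t : ℕ) → 1 ≤ n → 1 ≤ t → (K : FiniteField (3 ^ n)) →
    let open FiniteField K in
    (α β γ : F) → ¬ (α ≡ 0#) → ¬ (β ≡ 0#) → ¬ (γ ≡ 0#) →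
    (f : F → F) →
    f 0# ≡ 0# →
    (∀ x → C₀ x → f x ≡ α ⊗ (x ^ᶠ 3 ⊕ γ ⊗ x ^ᶠ 2 ⊕ γ ^ᶠ 2 ⊗ x)) →
    (∀ x → C₁ x → f x ≡ β ⊗ x ^ᶠ t) →
    Bijective _≡_ _≡_ f →
    (m : ℕ) → m ≤ 1 → EtaIs α m →
    (r : ℤ) (s : ℕ) → 1 ≤ s → s < (3 ^ n ∸ 1) / 2 →
    (+ s) *ℤ (+ t) +ℤ r *ℤ (+ ((3 ^ n ∸ 1) / 2)) ≡ + 1 →
    ∀ c →
      (⊝ (sumRange n (λ j → sumRange n (λ k →
            γ ⊗ ((α ⁻¹ ⊗ (γ ^ᶠ 3) ⁻¹ ⊗ f c) ^ᶠ ((3 ^ j +ℕ 3 ^ k) / 2))))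
          ⊗ (1# ⊕ negOnePow m ⊗ f c ^ᶠ ((3 ^ n ∸ 1) / 2))))
      ⊕ (⊝ ((negOnePow ∣ r ∣ ⊗ (β ⁻¹ ⊗ f c) ^ᶠ s)
          ⊗ (1# ⊕ negOnePow (m +ℕ 1) ⊗ f c ^ᶠ ((3 ^ n ∸ 1) / 2))))
      ≡ c
theorem9 n t _ 1≤t K α β γ α≢0 β≢0 γ≢0 f f-0 f-C₀ f-C₁ (f-injective , f-surjective) m m≤1 α∈Cₘ r s 1≤s s<h bezout c =
  trans (cong₂ (λ e e′ → ⊝ (u (f c) ⊗ (1# ⊕ e ⊗ f c ^ᶠ h)) ⊕ ⊝ (v (f c) ⊗ (1# ⊕ e′ ⊗ f c ^ᶠ h)))
               (sym ε≡εₘ) (trans (negOnePow-+1 m) (cong ⊝_ (sym ε≡εₘ))))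
        (f⁻¹∘f c)
  where
  open FiniteField K
  open FieldProperties K using (negOnePow-+1)
  open PiecewisePermutation n t K α β γ α≢0 β≢0 γ≢0 f f-0 f-C₀ f-C₁ f-injective
         (surjective⇒strictlySurjective f-surjective)
  1≤h : 1 ≤ h
  1≤h = ℕ.≤-trans 1≤s (ℕ.<⇒≤ s<h)
  t*s≡1+h*∣r∣ : t ℕ.* s ≡ suc (h ℕ.* ∣ r ∣)
  t*s≡1+h*∣r∣ = bezout⇒t*s≡1+h*∣r∣ r 1≤s 1≤t 1≤h bezout
  open InverseFormula s ∣ r ∣ 1≤s t*s≡1+h*∣r∣
  ε≡εₘ : ε ≡ negOnePow m
  ε≡εₘ = ε≡negOnePow m≤1 α∈Cₘ
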